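{- Let $[w,n]$ be a basis element of $\mathbf{W}$ and let $\alpha\vDash\ell(w)$ be the composition with $I(\alpha)=\mathrm{Des}(w)$. Then $$\Psi_{\le}([w,n])=L_\alpha,\quad\Psi_{>}([w,n])=L_{\alpha^{\mathtt c}},\quad\Psi_{\ge}([w^{\mathtt r},n])=L_{\alpha^{\mathtt r}},\quad\Psi_{<}([w^{\mathtt r},n])=L_{\alpha^{\mathtt t}}.$$
   Context: Fix a field $\mathbb{k}$. A word is a finite sequence of positive integers; $\ell(w)$ is its length; $w^{\mathtt r}$ is the reversed word; $\mathrm{Des}(w)=\{i\in\{1,\dots,\ell(w)-1\}:w_i>w_{i+1}\}$. $\mathbf{W}$ is the $\mathbb{k}$-vector space with basis symbols $[w,n]$ ($n\in\mathbb{N}$, $w$ a word with letters $\le n$). For a composition $\alpha=(\alpha_1,\dots,\alpha_r)\vDash N$, $I(\alpha)=\{\alpha_1,\alpha_1+\alpha_2,\dots,\alpha_1+\cdots+\alpha_{r-1}\}\subseteq\{1,\dots,N-1\}$; $\alpha^{\mathtt r}=(\alpha_r,\dots,\alpha_1)$; $\alpha^{\mathtt c}$ is the composition of $N$ with $I(\alpha^{\mathtt c})=\{1,\dots,N-1\}\setminus I(\alpha)$; $\alpha^{\mathtt t}=(\alpha^{\mathtt r})^{\mathtt c}$. $M_\alpha=\sum_{i_1<\cdots<i_r}x_{i_1}^{\alpha_1}\cdots x_{i_r}^{\alpha_r}$ ($M_\emptyset=1$) and $L_\alpha=\sum_{\beta\vDash N,\,I(\alpha)\subseteq I(\beta)}M_\beta$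 are quasi-symmetric functions. For $\bullet\in\{\le,\ge,<,>\}$, $\zeta_\bullet:\mathbf{W}\to\mathbb{k}$ is the linear map with $\zeta_\bullet([w,n])=1$ if $w$ is weakly increasing, weakly decreasing, strictly increasing, strictly decreasing respectively (the empty word counts as all of these), and $0$ otherwise. For a composition $\alpha=(\alpha_1,\dots,\alpha_r)$, $(\zeta_\bullet)_\alpha([w,n])=\prod_{i=1}^r\zeta_\bullet([w^{(i)},n])$ if $\alpha\vDash\ell(w)$ and $w=w^{(1)}\cdots w^{(r)}$ with $\ell(w^{(i)})=\alpha_i$, and $0$ if $\alpha$ is not a composition of $\ell(w)$; $(\zeta_\bullet)_\emptyset([w,n])=1$ if $w=\emptyset$ and $0$ otherwise. Then $\Psi_\bullet:\mathbf{W}\to\mathsf{QSym}$ is the linear map $\Psi_\bullet(x)=\sum_\alpha(\zeta_\bullet)_\alpha(x)M_\alpha$. -}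

module Defs where

open import Level using (Level; _⊔_)
open import Data.Nat using (ℕ; zero; suc; _+_; _<_; _≤_; _≤ᵇ_; _<ᵇ_; _≡ᵇ_)
open import Data.Bool using (Bool; true; false; if_then_else_; not; _∧_)
open import Data.List using (List; []; _∷_; length; take; drop; map; foldr; reverse)
open import Data.Nat.ListAction using (sum)
open import Data.Bool.ListAction using (any; all)
open import Data.List.Relation.Unary.All using (All)
open import Data.List.Membership.Propositional using (_∈_)
open import Data.Product using (∃; _×_)
open import Relation.Nullary using (¬_)
open import Relation.Binary.PropositionalEquality using (_≡_)
open import Function.Bundles using (_⇔_)
open import Algebra.Bundles using (CommutativeRing)

record Field (c ℓ : Level) : Set (Level.suc (c ⊔ ℓ)) where
  field
    commutativeRing : CommutativeRing c ℓ
  open CommutativeRing commutativeRing public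
  field
    0≉1 : ¬ (0# ≈ 1#)
    inverse : ∀ x → ¬ (x ≈ 0#) → ∃ λ y → x * y ≈ 1#

Word : Set
Word = List ℕ

IsBasisWord : Word → ℕ → Set
IsBasisWord w n = All (λ a → 1 ≤ a × a ≤ n) w

IsComposition : List ℕ → Set
IsComposition α = All (λ a → 0 < a) α

-- Des(w) = { i ∈ {1..ℓ(w)-1} : w_i > w_{i+1} } (1-indexed positions)
desFrom : ℕ → Word → List ℕ
desFrom i (a ∷ b ∷ w) =
  if b <ᵇ a then i ∷ desFrom (suc i) (b ∷ w) else desFrom (suc i) (b ∷ w)
desFrom i _ = []

Des : Word → List ℕ
Des w = desFrom 1 w

-- I(α) = {α₁, α₁+α₂, …, α₁+⋯+α_{r-1}}
Ifrom : ℕ → List ℕ → List ℕ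
Ifrom s (a ∷ b ∷ α) = (s + a) ∷ Ifrom (s + a) (b ∷ α)
Ifrom s _ = []

I : List ℕ → List ℕ
I α = Ifrom 0 α

_∈ᵇ_ : ℕ → List ℕ → Bool
i ∈ᵇ xs = any (i ≡ᵇ_) xs

-- the composition of N whose set I is { i ∈ {1..N-1} : S i }
build : ℕ → ℕ → ℕ → (ℕ → Bool) → List ℕ
build zero    i c S = c ∷ []
build (suc k) i c S =
  if S i then c ∷ build k (suc i) 1 S else build k (suc i) (suc c) S

fromSet : ℕ → (ℕ → Bool) → List ℕ
fromSet zero    S = []
fromSet (suc m) S = build m 1 1 S

_ᶜ : List ℕ → List ℕ
α ᶜ = fromSet (sum α) (λ i → not (i ∈ᵇ I α))

_ʳ : List ℕ → List ℕ
α ʳ = reverse α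

_ᵗ : List ℕ → List ℕ
α ᵗ = (α ʳ) ᶜ

chain : (ℕ → ℕ → Bool) → Word → Bool
chain R (a ∷ b ∷ w) = R a b ∧ chain R (b ∷ w)
chain R _ = true

data Kind : Set where
  ≤K ≥K <K >K : Kind

holds : Kind → Word → Bool
holds ≤K = chain (λ a b → a ≤ᵇ b)
holds ≥K = chain (λ a b → b ≤ᵇ a)
holds <K = chain (λ a b → a <ᵇ b)
holds >K = chain (λ a b → b <ᵇ a)

pieces : List ℕ → Word → List Word
pieces []      w = []
pieces (a ∷ α) w = take a w ∷ pieces α (drop a w)

-- QSym, represented by coefficient functions in the monomial basis M_β:
-- an element f corresponds to Σ_β f(β) M_β, β ranging over compositions.

module _ {c ℓ : Level} (F : Field c ℓ) where
  open Field F

  QSymElt : Set c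
  QSymElt = List ℕ → Carrier

  _≈Q_ : QSymElt → QSymElt → Set ℓ
  f ≈Q g = ∀ β → IsComposition β → f β ≈ g β

  boolTo : Bool → Carrier
  boolTo true  = 1#
  boolTo false = 0#

  ζ : Kind → Word → ℕ → Carrier
  ζ k w n = boolTo (holds k w)

  ζα : Kind → List ℕ → Word → ℕ → Carrier
  ζα k α w n =
    if sum α ≡ᵇ length w
    then foldr _*_ 1# (map (λ u → ζ k u n) (pieces α w))
    else 0#

  Ψ : Kind → Word → ℕ → QSymElt
  Ψ k w n β = ζα k β w n

  L : List ℕ → QSymElt
  L α β = boolTo ((sum β ≡ᵇ sum α) ∧ all (λ i → i ∈ᵇ I β) (I α))

-- Cut w at I(β).  Every piece is monotone for • exactly when every adjacent pair
-- (w_i, w_{i+1}) violating • straddles a cut, i.e. when the set of violating positions is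
-- contained in I(β).  So Ψ_•([w,n]) = L_γ for the composition γ of ℓ(w) whose I(γ) is the set
-- of violating positions.  For ≤ that set is Des w, giving α; for > it is the complement of
-- Des w in {1, …, ℓ(w) − 1}, giving α^c.  Reversing w moves position i to ℓ(w) − i, which on
-- the composition side is reversal, giving α^r for ≥ and (α^r)^c = α^t for <.

module Submission where

open import Defs
open import Level using (Level)
open import Data.Empty using (⊥-elim)
open import Data.Bool using (Bool; true; false; T; if_then_else_; not; _∧_; _∨_)
open import Data.Bool.Properties using (T-≡; ∨-zeroʳ; ∨-identityʳ; ∧-assoc; not-involutive)
open import Data.Bool.ListAction using (all)
open import Data.Nat using (ℕ; zero; suc; _+_; _∸_; _<_; _≤_; _≤ᵇ_; _<ᵇ_; _≡ᵇ_; z<s)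
open import Data.Nat.Properties
  using ( ≡ᵇ⇒≡; ≡⇒≡ᵇ; +-identityʳ; +-suc; +-comm; +-assoc; +-cancelʳ-≡; suc-injective
        ; ≤-refl; ≤-reflexive; ≤-trans; <-≤-trans; <⇒≤; <⇒≢; >⇒≢; ≤⇒≯; 1+n≰n
        ; n≤1+n; m≤m+n; m<m+n; m<n⇒m<1+n; m≤n⇒m<n∨m≡n )
open import Data.Nat.ListAction using (sum)
open import Data.Nat.ListAction.Properties using (sum-++; sum-↭)
open import Data.List using (List; []; _∷_; _++_; length; reverse; take; drop; map; foldr)
open import Data.List.Properties using (reverse-++; reverse-involutive; length-reverse; length-++; ++-assoc)
open import Data.List.Relation.Unary.All as All using (All; []; _∷_)
open import Data.List.Relation.Unary.All.Properties using (all-anti-mono)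
open import Data.List.Relation.Unary.Any as Any using (here; there)
open import Data.List.Relation.Unary.Any.Properties using (any⁺; any⁻)
open import Data.List.Membership.Propositional using (_∈_; _∉_)
open import Data.List.Relation.Binary.BagAndSetEquality using (_∼[_]_; set)
open import Data.List.Relation.Binary.Permutation.Propositional.Properties using (↭-reverse)
open import Data.Product using (_×_; _,_; proj₁; ∃; ∃₂; map₂) renaming (map to map-×)
open import Data.Product.Function.NonDependent.Propositional using (_×-⇔_)
open import Data.Sum using (_⊎_; inj₁; inj₂; [_,_])
open import Data.Sum.Function.Propositional using (_⊎-⇔_)
open import Function using (_∘_)
open import Function.Bundles using (_⇔_; mk⇔; Equivalence)
open import Function.Construct.Identity using (⇔-id)
open import Function.Related.TypeIsomorphisms using (¬-cong-⇔)
import Function.Properties.Equivalence as ⇔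
import Function.Related.Propositional as Related
open import Relation.Nullary using (¬_)
open import Relation.Binary.PropositionalEquality hiding ([_])

open Equivalence using (to; from)

T-injective : ∀ {a b} → T a ⇔ T b → a ≡ b
T-injective {false} {false} _ = refl
T-injective {false} {true}  a⇔b = ⊥-elim (from a⇔b _)
T-injective {true}  {false} a⇔b = ⊥-elim (to a⇔b _)
T-injective {true}  {true}  _ = refl

T-not⇔¬T : ∀ {b} → T (not b) ⇔ (¬ T b)
T-not⇔¬T {false} = mk⇔ (λ _ ()) _
T-not⇔¬T {true}  = mk⇔ (λ ()) (λ ¬tt → ¬tt _)

T-∈ᵇ : ∀ {i} xs → T (i ∈ᵇ xs) ⇔ i ∈ xs
T-∈ᵇ {i} xs = mk⇔ (Any.map (≡ᵇ⇒≡ i _) ∘ any⁻ _ xs) (any⁺ _ ∘ Any.map (≡⇒≡ᵇ i _))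

all-cong-set : ∀ (p : ℕ → Bool) {xs ys} → xs ∼[ set ] ys → all p xs ≡ all p ys
all-cong-set p xs∼ys = T-injective (mk⇔ (all-anti-mono p (from xs∼ys)) (all-anti-mono p (to xs∼ys)))

≢⇒≡ᵇ≡false : ∀ {m n} → m ≢ n → (m ≡ᵇ n) ≡ false
≢⇒≡ᵇ≡false {m} {n} m≢n with m ≡ᵇ n in m≡ᵇn
... | true  = ⊥-elim (m≢n (≡ᵇ⇒≡ m n (subst T (sym m≡ᵇn) _)))
... | false = refl

∈ᵇ≡false-below : ∀ {v} cs → All (v <_) cs → (v ∈ᵇ cs) ≡ false
∈ᵇ≡false-below []      []          = refl
∈ᵇ≡false-below (x ∷ cs) (v<x ∷ v<cs) = cong₂ _∨_ (≢⇒≡ᵇ≡false (<⇒≢ v<x)) (∈ᵇ≡false-below cs v<cs)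

<ᵇ-suc≡not-flip-<ᵇ : ∀ a b → (a <ᵇ suc b) ≡ not (b <ᵇ a)
<ᵇ-suc≡not-flip-<ᵇ zero    b       = refl
<ᵇ-suc≡not-flip-<ᵇ (suc a) zero    = refl
<ᵇ-suc≡not-flip-<ᵇ (suc a) (suc b) = <ᵇ-suc≡not-flip-<ᵇ a b

≤ᵇ≡not-flip-<ᵇ : ∀ a b → (a ≤ᵇ b) ≡ not (b <ᵇ a)
≤ᵇ≡not-flip-<ᵇ zero    b       = refl
≤ᵇ≡not-flip-<ᵇ (suc a) zero    = refl
≤ᵇ≡not-flip-<ᵇ (suc a) (suc b) = <ᵇ-suc≡not-flip-<ᵇ a b

∈-∷⇔ : ∀ {x y : ℕ} {ys} → x ∈ y ∷ ys ⇔ (x ≡ y ⊎ x ∈ ys)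
∈-∷⇔ = mk⇔ Any.toSum [ here , there ]

∉-∷⇔ : ∀ {x y : ℕ} {ys} → x ≢ y → x ∉ ys ⇔ x ∉ y ∷ ys
∉-∷⇔ x≢y = mk⇔ (λ x∉ys → [ x≢y , x∉ys ] ∘ Any.toSum) (λ x∉y∷ys → x∉y∷ys ∘ there)

positionsFrom : (ℕ → ℕ → Bool) → ℕ → Word → List ℕ
positionsFrom B s (a ∷ b ∷ w) =
  if B a b then s ∷ positionsFrom B (suc s) (b ∷ w) else positionsFrom B (suc s) (b ∷ w)
positionsFrom B s _ = []

desFrom≡positionsFrom : ∀ s w → desFrom s w ≡ positionsFrom (λ a b → b <ᵇ a) s w
desFrom≡positionsFrom s []          = refl
desFrom≡positionsFrom s (a ∷ [])    = refl
desFrom≡positionsFrom s (a ∷ b ∷ w) =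
  cong (λ r → if b <ᵇ a then s ∷ r else r) (desFrom≡positionsFrom (suc s) (b ∷ w))

-- Monotone pieces and cuts

chainExcept : (ℕ → ℕ → Bool) → ℕ → List ℕ → Word → Bool
chainExcept R s cs (a ∷ b ∷ w) = ((s ∈ᵇ cs) ∨ R a b) ∧ chainExcept R (suc s) cs (b ∷ w)
chainExcept R s cs _ = true

all-if-cons : ∀ (p : ℕ → Bool) s β {X} Y → X ≡ all p Y →
  (p s ∨ not β) ∧ X ≡ all p (if β then s ∷ Y else Y)
all-if-cons p s true  Y X≡ = cong₂ _∧_ (∨-identityʳ (p s)) X≡
all-if-cons p s false Y X≡ = trans (cong (_∧ _) (∨-zeroʳ (p s))) X≡

chainExcept≡all-positions : ∀ {R B} → (∀ a b → R a b ≡ not (B a b)) → ∀ s cs w →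
  chainExcept R s cs w ≡ all (_∈ᵇ cs) (positionsFrom B s w)
chainExcept≡all-positions R≡¬B s cs []          = refl
chainExcept≡all-positions R≡¬B s cs (a ∷ [])    = refl
chainExcept≡all-positions {B = B} R≡¬B s cs (a ∷ b ∷ w) =
  trans (cong (λ r → ((s ∈ᵇ cs) ∨ r) ∧ _) (R≡¬B a b))
        (all-if-cons (_∈ᵇ cs) s (B a b) _ (chainExcept≡all-positions R≡¬B (suc s) cs (b ∷ w)))

chainExcept-past-cut : ∀ R {s v} cs w → v < s → chainExcept R s (v ∷ cs) w ≡ chainExcept R s cs w
chainExcept-past-cut R cs []          v<s = refl
chainExcept-past-cut R cs (a ∷ [])    v<s = refl
chainExcept-past-cut R {s} cs (a ∷ b ∷ w) v<s =
  cong₂ (λ x y → ((x ∨ (s ∈ᵇ cs)) ∨ R a b) ∧ y)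
      (≢⇒≡ᵇ≡false (>⇒≢ v<s)) (chainExcept-past-cut R cs (b ∷ w) (m<n⇒m<1+n v<s))

chainExcept-cut-here : ∀ R {s} cs a b w →
  chainExcept R s (s ∷ cs) (a ∷ b ∷ w) ≡ chainExcept R (suc s) (s ∷ cs) (b ∷ w)
chainExcept-cut-here R {s} cs a b w =
  cong (λ t → ((t ∨ (s ∈ᵇ cs)) ∨ R a b) ∧ chainExcept R (suc s) (s ∷ cs) (b ∷ w))
    (to T-≡ (≡⇒≡ᵇ s s refl))

Ifrom-suc-head : ∀ s a α → Ifrom s (suc a ∷ α) ≡ Ifrom (suc s) (a ∷ α)
Ifrom-suc-head s a []      = refl
Ifrom-suc-head s a (b ∷ α) = cong (λ t → t ∷ Ifrom t (b ∷ α)) (+-suc s a)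

Ifrom-≥ : ∀ s a α → All (s + a ≤_) (Ifrom s (a ∷ α))
Ifrom-≥ s a []      = []
Ifrom-≥ s a (b ∷ α) =
  ≤-refl ∷ All.map (≤-trans (m≤m+n (s + a) b)) (Ifrom-≥ (s + a) b α)

all-chain-pieces : ∀ R s β w → IsComposition β → sum β ≡ length w →
  all (chain R) (pieces β w) ≡ chainExcept R (suc s) (Ifrom s β) w
all-chain-pieces R s []                    []          _            _ = refl
all-chain-pieces R s (zero ∷ α)            w           (() ∷ _)     _
all-chain-pieces R s (suc a ∷ [])          []          _            ()
all-chain-pieces R s (suc a ∷ zero ∷ α)    w           (_ ∷ () ∷ _) _
all-chain-pieces R s (suc zero ∷ [])       (x ∷ [])    _            _ = refl
all-chain-pieces R s (suc zero ∷ suc b ∷ α) (x ∷ y ∷ w) (_ ∷ α-pos) e =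
  begin
    all (chain R) (pieces (suc b ∷ α) (y ∷ w))
  ≡⟨ all-chain-pieces R (suc s) (suc b ∷ α) (y ∷ w) α-pos (suc-injective e) ⟩
    chainExcept R (2 + s) (Ifrom (suc s) (suc b ∷ α)) (y ∷ w)
  ≡⟨ chainExcept-past-cut R _ (y ∷ w) ≤-refl ⟨
    chainExcept R (2 + s) (suc s ∷ Ifrom (suc s) (suc b ∷ α)) (y ∷ w)
  ≡⟨ chainExcept-cut-here R _ x y w ⟨
    chainExcept R (suc s) (suc s ∷ Ifrom (suc s) (suc b ∷ α)) (x ∷ y ∷ w)
  ≡⟨ cong (λ t → chainExcept R (suc s) (t ∷ Ifrom t (suc b ∷ α)) (x ∷ y ∷ w)) (+-comm s 1) ⟨
    chainExcept R (suc s) (Ifrom s (1 ∷ suc b ∷ α)) (x ∷ y ∷ w)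
  ∎
  where open ≡-Reasoning
all-chain-pieces R s (suc (suc a) ∷ α) (x ∷ y ∷ w) (_ ∷ α-pos) e =
  begin
    (R x y ∧ chain R (y ∷ take a w)) ∧ all (chain R) (pieces α (drop a w))
  ≡⟨ ∧-assoc (R x y) _ _ ⟩
    R x y ∧ all (chain R) (pieces (suc a ∷ α) (y ∷ w))
  ≡⟨ cong (R x y ∧_) (all-chain-pieces R (suc s) (suc a ∷ α) (y ∷ w) (z<s ∷ α-pos) (suc-injective e)) ⟩
    R x y ∧ chainExcept R (2 + s) cs (y ∷ w)
  ≡⟨ cong (λ b → (b ∨ R x y) ∧ chainExcept R (2 + s) cs (y ∷ w)) suc-s∉cs ⟨
    chainExcept R (suc s) cs (x ∷ y ∷ w)
  ≡⟨ cong (λ ds → chainExcept R (suc s) ds (x ∷ y ∷ w)) (Ifrom-suc-head s (suc a) α) ⟨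
    chainExcept R (suc s) (Ifrom s (suc (suc a) ∷ α)) (x ∷ y ∷ w)
  ∎
  where
  open ≡-Reasoning
  cs = Ifrom (suc s) (suc a ∷ α)
  suc-s∉cs : (suc s ∈ᵇ cs) ≡ false
  suc-s∉cs = ∈ᵇ≡false-below cs (All.map (<-≤-trans (m<m+n (suc s) z<s)) (Ifrom-≥ (suc s) (suc a) α))

module _ {c ℓ : Level} (F : Field c ℓ) where
  open Field F using (_≈_; _*_; 1#; 0#; *-identityˡ; zeroˡ; *-congˡ; reflexive)
    renaming (refl to ≈-refl; trans to ≈-trans)

  boolTo-∧ : ∀ a b → boolTo F a * boolTo F b ≈ boolTo F (a ∧ b)
  boolTo-∧ true  b = *-identityˡ _
  boolTo-∧ false b = zeroˡ _

  product-boolTo : ∀ (p : Word → Bool) ws → foldr _*_ 1# (map (boolTo F ∘ p) ws) ≈ boolTo F (all p ws)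
  product-boolTo p []       = ≈-refl
  product-boolTo p (u ∷ ws) = ≈-trans (*-congˡ (product-boolTo p ws)) (boolTo-∧ (p u) (all p ws))

  Ψ≈L : ∀ k {R B} w n γ → holds k ≡ chain R → (∀ a b → R a b ≡ not (B a b)) →
    sum γ ≡ length w → I γ ∼[ set ] positionsFrom B 1 w → _≈Q_ F (Ψ F k w n) (L F γ)
  Ψ≈L k {R} {B} w n γ holds≡chain R≡¬B Σγ≡ℓw Iγ∼B β β-comp rewrite Σγ≡ℓw
    with sum β ≡ᵇ length w in Σβ≡ℓw
  ... | false = ≈-refl
  ... | true  = ≈-trans (product-boolTo (holds k) (pieces β w)) (reflexive (cong (boolTo F) chain≡cut))
    where
    open ≡-Reasoning
    chain≡cut : all (holds k) (pieces β w) ≡ all (_∈ᵇ I β) (I γ)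
    chain≡cut = begin
      all (holds k) (pieces β w)
        ≡⟨ cong (λ p → all p (pieces β w)) holds≡chain ⟩
      all (chain R) (pieces β w)
        ≡⟨ all-chain-pieces R 0 β w β-comp (≡ᵇ⇒≡ _ _ (subst T (sym Σβ≡ℓw) _)) ⟩
      chainExcept R 1 (I β) w
        ≡⟨ chainExcept≡all-positions R≡¬B 1 (I β) w ⟩
      all (_∈ᵇ I β) (positionsFrom B 1 w)
        ≡⟨ all-cong-set (_∈ᵇ I β) Iγ∼B ⟨
      all (_∈ᵇ I β) (I γ)
        ∎

-- Complementary compositions

infix 4 _∈[_,+_⟩
_∈[_,+_⟩ : ℕ → ℕ → ℕ → Set
i ∈[ s ,+ m ⟩ = s ≤ i × i < s + m

∉-interval-zero : ∀ {i} s → ¬ i ∈[ s ,+ 0 ⟩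
∉-interval-zero s (s≤i , i<s+0) = ≤⇒≯ s≤i (subst (_ <_) (+-identityʳ s) i<s+0)

∈-interval-suc : ∀ {i s m} → i ∈[ s ,+ suc m ⟩ ⇔ (i ≡ s ⊎ i ∈[ suc s ,+ m ⟩)
∈-interval-suc {i} {s} {m} = mk⇔ split join
  where
  split : i ∈[ s ,+ suc m ⟩ → i ≡ s ⊎ i ∈[ suc s ,+ m ⟩
  split (s≤i , i<) with m≤n⇒m<n∨m≡n s≤i
  ... | inj₁ s<i = inj₂ (s<i , subst (i <_) (+-suc s m) i<)
  ... | inj₂ s≡i = inj₁ (sym s≡i)
  join : i ≡ s ⊎ i ∈[ suc s ,+ m ⟩ → i ∈[ s ,+ suc m ⟩
  join (inj₁ refl)       = ≤-refl , m<m+n s z<s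
  join (inj₂ (s<i , i<)) = <⇒≤ s<i , subst (i <_) (sym (+-suc s m)) i<

module _ {Q Q′ : ℕ → Set} {s m : ℕ} (Q⇔Q′ : ∀ {i} → i ≢ s → Q i ⇔ Q′ i) where

  ∈-interval-suc-head : Q′ s → ∀ {i} →
    (i ≡ s ⊎ (i ∈[ suc s ,+ m ⟩ × Q i)) ⇔ (i ∈[ s ,+ suc m ⟩ × Q′ i)
  ∈-interval-suc-head Q′s = mk⇔ to′ from′
    where
    to′ : ∀ {i} → i ≡ s ⊎ (i ∈[ suc s ,+ m ⟩ × Q i) → i ∈[ s ,+ suc m ⟩ × Q′ i
    to′ (inj₁ refl)    = from ∈-interval-suc (inj₁ refl) , Q′s
    to′ (inj₂ (r , q)) = from ∈-interval-suc (inj₂ r) , to (Q⇔Q′ (>⇒≢ (proj₁ r))) q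
    from′ : ∀ {i} → i ∈[ s ,+ suc m ⟩ × Q′ i → i ≡ s ⊎ (i ∈[ suc s ,+ m ⟩ × Q i)
    from′ (r , q′) with to ∈-interval-suc r
    ... | inj₁ i≡s = inj₁ i≡s
    ... | inj₂ r′  = inj₂ (r′ , from (Q⇔Q′ (>⇒≢ (proj₁ r′))) q′)

  ∈-interval-suc-skip : ¬ Q′ s → ∀ {i} →
    (i ∈[ suc s ,+ m ⟩ × Q i) ⇔ (i ∈[ s ,+ suc m ⟩ × Q′ i)
  ∈-interval-suc-skip ¬Q′s = mk⇔ to′ from′
    where
    to′ : ∀ {i} → i ∈[ suc s ,+ m ⟩ × Q i → i ∈[ s ,+ suc m ⟩ × Q′ i
    to′ (r , q) = from ∈-interval-suc (inj₂ r) , to (Q⇔Q′ (>⇒≢ (proj₁ r))) q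
    from′ : ∀ {i} → i ∈[ s ,+ suc m ⟩ × Q′ i → i ∈[ suc s ,+ m ⟩ × Q i
    from′ (r , q′) with to ∈-interval-suc r
    ... | inj₁ refl = ⊥-elim (¬Q′s q′)
    ... | inj₂ r′   = r′ , from (Q⇔Q′ (>⇒≢ (proj₁ r′))) q′

Ifrom-cons-build : ∀ s c k j d S →
  Ifrom s (c ∷ build k j d S) ≡ (s + c) ∷ Ifrom (s + c) (build k j d S)
Ifrom-cons-build s c zero    j d S = refl
Ifrom-cons-build s c (suc k) j d S with S j
... | true  = refl
... | false = Ifrom-cons-build s c k (suc j) (suc d) S

∈-I-build : ∀ m s c j S → s + c ≡ j → ∀ {x} →
  x ∈ Ifrom s (build m j c S) ⇔ (x ∈[ j ,+ m ⟩ × T (S x))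
∈-I-build zero    s c j S _ = mk⇔ (λ ()) (λ (r , _) → ⊥-elim (∉-interval-zero j r))
∈-I-build (suc k) s c j S s+c≡j {x} with S j in Sj≡
... | true  = begin
    x ∈ Ifrom s (c ∷ build k (suc j) 1 S)
      ≡⟨ cong (x ∈_) (Ifrom-cons-build s c k (suc j) 1 S) ⟩
    x ∈ (s + c) ∷ Ifrom (s + c) (build k (suc j) 1 S)
      ∼⟨ ∈-∷⇔ ⟩
    (x ≡ s + c ⊎ x ∈ Ifrom (s + c) (build k (suc j) 1 S))
      ∼⟨ Related.≡⇒ (cong (x ≡_) s+c≡j) ⊎-⇔ ∈-I-build k (s + c) 1 (suc j) S s+c+1≡ ⟩
    (x ≡ j ⊎ (x ∈[ suc j ,+ k ⟩ × T (S x)))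
      ∼⟨ ∈-interval-suc-head (λ _ → ⇔-id _) (subst T (sym Sj≡) _) ⟩
    (x ∈[ j ,+ suc k ⟩ × T (S x))
      ∎
  where
  open Related.EquationalReasoning
  s+c+1≡ : s + c + 1 ≡ suc j
  s+c+1≡ = trans (+-comm (s + c) 1) (cong suc s+c≡j)
... | false = begin
    x ∈ Ifrom s (build k (suc j) (suc c) S)
      ∼⟨ ∈-I-build k s (suc c) (suc j) S (trans (+-suc s c) (cong suc s+c≡j)) ⟩
    (x ∈[ suc j ,+ k ⟩ × T (S x))
      ∼⟨ ∈-interval-suc-skip (λ _ → ⇔-id _) (subst T Sj≡) ⟩
    (x ∈[ j ,+ suc k ⟩ × T (S x))
      ∎
  where open Related.EquationalReasoning

∈-I-fromSet : ∀ N S {i} → i ∈ I (fromSet N S) ⇔ (i ∈[ 1 ,+ N ∸ 1 ⟩ × T (S i))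
∈-I-fromSet zero    S = mk⇔ (λ ()) (λ (r , _) → ⊥-elim (∉-interval-zero 1 r))
∈-I-fromSet (suc m) S = ∈-I-build m 0 1 1 S refl

sum-build : ∀ k j c S → sum (build k j c S) ≡ c + k
sum-build zero    j c S = refl
sum-build (suc k) j c S with S j
... | true  = cong (c +_) (sum-build k (suc j) 1 S)
... | false = trans (sum-build k (suc j) (suc c) S) (sym (+-suc c k))

sum-ᶜ : ∀ α → sum (α ᶜ) ≡ sum α
sum-ᶜ α with sum α
... | zero  = refl
... | suc m = sum-build m 1 1 _

positionsFrom-≥ : ∀ B s w {i} → i ∈ positionsFrom B s w → s ≤ i
positionsFrom-≥ B s (a ∷ b ∷ w) {i} i∈ with B a b | positionsFrom-≥ B (suc s) (b ∷ w) {i}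
... | true  | ih = [ ≤-reflexive ∘ sym , ≤-trans (n≤1+n s) ∘ ih ] (Any.toSum i∈)
... | false | ih = ≤-trans (n≤1+n s) (ih i∈)

∈-positions-not : ∀ B s w {i} →
  i ∈ positionsFrom (λ a b → not (B a b)) s w ⇔ (i ∈[ s ,+ length w ∸ 1 ⟩ × i ∉ positionsFrom B s w)
∈-positions-not B s []          = mk⇔ (λ ()) (λ (r , _) → ⊥-elim (∉-interval-zero s r))
∈-positions-not B s (a ∷ [])    = mk⇔ (λ ()) (λ (r , _) → ⊥-elim (∉-interval-zero s r))
∈-positions-not B s (a ∷ b ∷ w) {i} with B a b | ∈-positions-not B (suc s) (b ∷ w) {i}
... | true  | ih = begin
    i ∈ positionsFrom (λ a b → not (B a b)) (suc s) (b ∷ w)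
      ∼⟨ ih ⟩
    (i ∈[ suc s ,+ length w ⟩ × i ∉ positionsFrom B (suc s) (b ∷ w))
      ∼⟨ ∈-interval-suc-skip ∉-∷⇔ (λ s∉ → s∉ (here refl)) ⟩
    (i ∈[ s ,+ suc (length w) ⟩ × i ∉ s ∷ positionsFrom B (suc s) (b ∷ w))
      ∎
  where open Related.EquationalReasoning
... | false | ih = begin
    i ∈ s ∷ positionsFrom (λ a b → not (B a b)) (suc s) (b ∷ w)
      ∼⟨ ∈-∷⇔ ⟩
    (i ≡ s ⊎ i ∈ positionsFrom (λ a b → not (B a b)) (suc s) (b ∷ w))
      ∼⟨ ⇔-id _ ⊎-⇔ ih ⟩
    (i ≡ s ⊎ (i ∈[ suc s ,+ length w ⟩ × i ∉ positionsFrom B (suc s) (b ∷ w)))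
      ∼⟨ ∈-interval-suc-head (λ _ → ⇔-id _) (1+n≰n ∘ positionsFrom-≥ B (suc s) (b ∷ w)) ⟩
    (i ∈[ s ,+ suc (length w) ⟩ × i ∉ positionsFrom B (suc s) (b ∷ w))
      ∎
  where open Related.EquationalReasoning

I-ᶜ∼positions-not : ∀ B γ w → sum γ ≡ length w → I γ ∼[ set ] positionsFrom B 1 w →
  I (γ ᶜ) ∼[ set ] positionsFrom (λ a b → not (B a b)) 1 w
I-ᶜ∼positions-not B γ w Σγ≡ℓw Iγ∼B {i} = begin
  i ∈ I (γ ᶜ)
    ∼⟨ ∈-I-fromSet (sum γ) _ ⟩
  (i ∈[ 1 ,+ sum γ ∸ 1 ⟩ × T (not (i ∈ᵇ I γ)))
    ∼⟨ Related.≡⇒ (cong (λ N → i ∈[ 1 ,+ N ∸ 1 ⟩) Σγ≡ℓw)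
         ×-⇔ ⇔.trans T-not⇔¬T (¬-cong-⇔ (⇔.trans (T-∈ᵇ (I γ)) Iγ∼B)) ⟩
  (i ∈[ 1 ,+ length w ∸ 1 ⟩ × i ∉ positionsFrom B 1 w)
    ∼⟨ ⇔.sym (∈-positions-not B 1 w) ⟩
  i ∈ positionsFrom (λ a b → not (B a b)) 1 w
    ∎
  where open Related.EquationalReasoning

-- Reversal

-- The reflection i ↦ N x − i, stated additively; as r is an involution, one direction suffices.
module _ {A : Set} (P : A → ℕ → Set) (r : A → A) (N : A → ℕ)
         (r-involutive : ∀ x → r (r x) ≡ x) (N∘r≗N : ∀ x → N (r x) ≡ N x)
         (mirror : ∀ x {j} → P x j → ∃ λ i → P (r x) i × i + j ≡ N x) where

  mirror⇔ : ∀ x {i} → P (r x) i ⇔ (∃ λ j → P x j × i + j ≡ N x)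
  mirror⇔ x {i} = mk⇔ to′ from′
    where
    to′ : P (r x) i → ∃ λ j → P x j × i + j ≡ N x
    to′ p = let j , q , j+i≡ = mirror (r x) p in
      j , subst (λ y → P y j) (r-involutive x) q , trans (+-comm i j) (trans j+i≡ (N∘r≗N x))
    from′ : (∃ λ j → P x j × i + j ≡ N x) → P (r x) i
    from′ (j , q , i+j≡) = let k , p , k+j≡ = mirror x q in
      subst (P (r x)) (+-cancelʳ-≡ j k i (trans k+j≡ (sym i+j≡))) p

sum-reverse : ∀ xs → sum (reverse xs) ≡ sum xs
sum-reverse xs = sum-↭ (↭-reverse xs)

CutAt : ℕ → List ℕ → ℕ → Set
CutAt s α i = ∃₂ λ α₁ α₂ → 0 < length α₁ × 0 < length α₂ × α ≡ α₁ ++ α₂ × s + sum α₁ ≡ i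

∈-Ifrom⁻ : ∀ s α {i} → i ∈ Ifrom s α → CutAt s α i
∈-Ifrom⁻ s (a ∷ b ∷ α) (here i≡) =
  a ∷ [] , b ∷ α , z<s , z<s , refl , trans (cong (s +_) (+-identityʳ a)) (sym i≡)
∈-Ifrom⁻ s (a ∷ b ∷ α) (there i∈) =
  let α₁ , α₂ , _ , 0<∣α₂∣ , α≡ , s+a+Σα₁≡i = ∈-Ifrom⁻ (s + a) (b ∷ α) i∈
  in a ∷ α₁ , α₂ , z<s , 0<∣α₂∣ , cong (a ∷_) α≡ , trans (sym (+-assoc s a (sum α₁))) s+a+Σα₁≡i

∈-Ifrom⁺ : ∀ s α₁ α₂ {i} → 0 < length α₁ → 0 < length α₂ → s + sum α₁ ≡ i → i ∈ Ifrom s (α₁ ++ α₂)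
∈-Ifrom⁺ s (a ∷ [])     (b ∷ α₂) _ _      s+Σα₁≡i = here (trans (sym s+Σα₁≡i) (cong (s +_) (+-identityʳ a)))
∈-Ifrom⁺ s (a ∷ c ∷ α₁) α₂       _ 0<∣α₂∣ s+Σα₁≡i =
  there (∈-Ifrom⁺ (s + a) (c ∷ α₁) α₂ z<s 0<∣α₂∣ (trans (+-assoc s a _) s+Σα₁≡i))

I-reverse-mirror : ∀ α {j} → j ∈ I α → ∃ λ i → i ∈ I (reverse α) × i + j ≡ sum α
I-reverse-mirror α {j} j∈ =
  let α₁ , α₂ , 0<∣α₁∣ , 0<∣α₂∣ , α≡ , Σα₁≡j = ∈-Ifrom⁻ 0 α j∈
      reverse-α≡ = trans (cong reverse α≡) (reverse-++ α₁ α₂)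
  in sum α₂
   , subst (λ β → sum α₂ ∈ I β) (sym reverse-α≡)
       (∈-Ifrom⁺ 0 (reverse α₂) (reverse α₁)
         (subst (0 <_) (sym (length-reverse α₂)) 0<∣α₂∣)
         (subst (0 <_) (sym (length-reverse α₁)) 0<∣α₁∣)
         (sum-reverse α₂))
   , (begin
       sum α₂ + j           ≡⟨ cong (sum α₂ +_) Σα₁≡j ⟨
       sum α₂ + sum α₁      ≡⟨ +-comm (sum α₂) (sum α₁) ⟩
       sum α₁ + sum α₂      ≡⟨ sum-++ α₁ α₂ ⟨
       sum (α₁ ++ α₂)       ≡⟨ cong sum α≡ ⟨
       sum α                ∎)
  where open ≡-Reasoning

PairAt : (ℕ → ℕ → Bool) → ℕ → Word → ℕ → Set
PairAt B s w i = ∃₂ λ u v → ∃₂ λ a b → T (B a b) × w ≡ u ++ a ∷ b ∷ v × s + length u ≡ i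

PairAt-∷ : ∀ {B s w i} c → PairAt B (suc s) w i → PairAt B s (c ∷ w) i
PairAt-∷ {s = s} c (u , v , a , b , Bab , w≡ , e) =
  c ∷ u , v , a , b , Bab , cong (c ∷_) w≡ , trans (+-suc s (length u)) e

∈-positionsFrom⁻ : ∀ B s w {i} → i ∈ positionsFrom B s w → PairAt B s w i
∈-positionsFrom⁻ B s (a ∷ b ∷ w) {i} i∈ with B a b in Bab≡ | ∈-positionsFrom⁻ B (suc s) (b ∷ w) {i}
... | true  | ih = [ (λ i≡s → [] , w , a , b , subst T (sym Bab≡) _ , refl , trans (+-identityʳ s) (sym i≡s))
                   , PairAt-∷ a ∘ ih
                   ] (Any.toSum i∈)
... | false | ih = PairAt-∷ a (ih i∈)

positionsFrom-∷⁺ : ∀ B s c w {i} → i ∈ positionsFrom B (suc s) w → i ∈ positionsFrom B s (c ∷ w)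
positionsFrom-∷⁺ B s c (d ∷ w) i∈ with B c d
... | true  = there i∈
... | false = i∈

∈-positionsFrom⁺ : ∀ B s u v {a b i} → T (B a b) → s + length u ≡ i →
  i ∈ positionsFrom B s (u ++ a ∷ b ∷ v)
∈-positionsFrom⁺ B s []      v {a} {b} Bab s+0≡i with B a b
... | true = here (trans (sym s+0≡i) (+-identityʳ s))
∈-positionsFrom⁺ B s (c ∷ u) v {a} {b} Bab s+∣c∷u∣≡i =
  positionsFrom-∷⁺ B s c (u ++ a ∷ b ∷ v)
    (∈-positionsFrom⁺ B (suc s) u v Bab (trans (sym (+-suc s (length u))) s+∣c∷u∣≡i))

reverse-++-∷-∷ : ∀ (u : Word) a b v → reverse (u ++ a ∷ b ∷ v) ≡ reverse v ++ b ∷ a ∷ reverse u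
reverse-++-∷-∷ u a b v = begin
  reverse (u ++ a ∷ b ∷ v)                ≡⟨ reverse-++ u (a ∷ b ∷ v) ⟩
  reverse ((a ∷ b ∷ []) ++ v) ++ reverse u ≡⟨ cong (_++ reverse u) (reverse-++ (a ∷ b ∷ []) v) ⟩
  (reverse v ++ b ∷ a ∷ []) ++ reverse u  ≡⟨ ++-assoc (reverse v) (b ∷ a ∷ []) (reverse u) ⟩
  reverse v ++ b ∷ a ∷ reverse u          ∎
  where open ≡-Reasoning

positions-reverse-mirror : ∀ B w {j} → j ∈ positionsFrom B 1 w →
  ∃ λ i → i ∈ positionsFrom (λ a b → B b a) 1 (reverse w) × i + j ≡ length w
positions-reverse-mirror B w {j} j∈ =
  let u , v , a , b , Bab , w≡ , 1+∣u∣≡j = ∈-positionsFrom⁻ B 1 w j∈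
  in suc (length v)
   , subst (λ x → suc (length v) ∈ positionsFrom (λ a b → B b a) 1 x)
       (sym (trans (cong reverse w≡) (reverse-++-∷-∷ u a b v)))
       (∈-positionsFrom⁺ (λ a b → B b a) 1 (reverse v) (reverse u) Bab (cong suc (length-reverse v)))
   , (begin
       suc (length v) + j                 ≡⟨ cong (suc (length v) +_) 1+∣u∣≡j ⟨
       suc (length v) + suc (length u)    ≡⟨ +-comm (suc (length v)) (suc (length u)) ⟩
       suc (length u + suc (length v))    ≡⟨ +-suc (length u) (suc (length v)) ⟨
       length u + length (a ∷ b ∷ v)      ≡⟨ length-++ u ⟨
       length (u ++ a ∷ b ∷ v)            ≡⟨ cong length w≡ ⟨
       length w                           ∎)
  where open ≡-Reasoning

I-ʳ∼positions-flip : ∀ B α w → sum α ≡ length w → I α ∼[ set ] positionsFrom B 1 w →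
  I (α ʳ) ∼[ set ] positionsFrom (λ a b → B b a) 1 (reverse w)
I-ʳ∼positions-flip B α w Σα≡ℓw Iα∼B {i} = begin
  i ∈ I (reverse α)
    ∼⟨ mirror⇔ (λ α i → i ∈ I α) reverse sum reverse-involutive sum-reverse I-reverse-mirror α ⟩
  (∃ λ j → j ∈ I α × i + j ≡ sum α)
    ∼⟨ mk⇔ (map₂ (map-× (to Iα∼B) (λ e → trans e Σα≡ℓw)))
           (map₂ (map-× (from Iα∼B) (λ e → trans e (sym Σα≡ℓw)))) ⟩
  (∃ λ j → j ∈ positionsFrom B 1 w × i + j ≡ length w)
    ∼⟨ ⇔.sym (mirror⇔ (λ (B , w) i → i ∈ positionsFrom B 1 w) (λ (B , w) → (λ a b → B b a) , reverse w)
         (λ (B , w) → length w) (λ (B , w) → cong (B ,_) (reverse-involutive w))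
         (λ (B , w) → length-reverse w) (λ (B , w) → positions-reverse-mirror B w) (B , w)) ⟩
  i ∈ positionsFrom (λ a b → B b a) 1 (reverse w)
    ∎
  where open Related.EquationalReasoning

proposition5p5 : {c ℓ : Level} (F : Field c ℓ) (w : List ℕ) (n : ℕ) (α : List ℕ) →
    IsBasisWord w n →
    IsComposition α → sum α ≡ length w → (∀ i → (i ∈ I α) ⇔ (i ∈ Des w)) →
    _≈Q_ F (Ψ F ≤K w n) (L F α)
    × _≈Q_ F (Ψ F >K w n) (L F (α ᶜ))
    × _≈Q_ F (Ψ F ≥K (reverse w) n) (L F (α ʳ))
    × _≈Q_ F (Ψ F <K (reverse w) n) (L F (α ᵗ))
proposition5p5 F w n α _ _ Σα≡ℓw Iα⇔Des =
    Ψ≈L F ≤K w n α refl ≤ᵇ≡not-flip-<ᵇ Σα≡ℓw Iα∼Des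
  , Ψ≈L F >K w n (α ᶜ) refl (λ _ _ → sym (not-involutive _))
      (trans (sum-ᶜ α) Σα≡ℓw) (I-ᶜ∼positions-not _ α w Σα≡ℓw Iα∼Des)
  , Ψ≈L F ≥K (reverse w) n (α ʳ) refl (λ a b → ≤ᵇ≡not-flip-<ᵇ b a) Σαʳ≡ℓwʳ Iαʳ∼Asc
  , Ψ≈L F <K (reverse w) n (α ᵗ) refl (λ _ _ → sym (not-involutive _))
      (trans (sum-ᶜ (α ʳ)) Σαʳ≡ℓwʳ) (I-ᶜ∼positions-not _ (α ʳ) (reverse w) Σαʳ≡ℓwʳ Iαʳ∼Asc)
  where
  Iα∼Des : I α ∼[ set ] positionsFrom (λ a b → b <ᵇ a) 1 w
  Iα∼Des {i} = subst (λ ds → i ∈ I α ⇔ i ∈ ds) (desFrom≡positionsFrom 1 w) (Iα⇔Des i)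
  Σαʳ≡ℓwʳ : sum (α ʳ) ≡ length (reverse w)
  Σαʳ≡ℓwʳ = trans (sum-reverse α) (trans Σα≡ℓw (sym (length-reverse w)))
  Iαʳ∼Asc : I (α ʳ) ∼[ set ] positionsFrom (λ a b → a <ᵇ b) 1 (reverse w)
  Iαʳ∼Asc = I-ʳ∼positions-flip _ α w Σα≡ℓw Iα∼Des
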